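{- Let $\Gamma$ be a finite multiset of propositional formulas and $A$ a propositional formula. If $\Gamma \vdash_c A$ (classical propositional derivability) and $$(\mathcal{V}^-(\Gamma) \cup \mathcal{V}^+(A)) \cap (\mathcal{V}^+_{ns}(\Gamma) \cup \mathcal{V}^-(A)) = \emptyset,$$ then $\Gamma \vdash_i A$ (intuitionistic propositional derivability).
   Context: Formulas are built from propositional variables and $\bot$ using $\land$, $\lor$, $\rightarrow$. The sets $\mathcal{V}^+(A)$, $\mathcal{V}^-(A)$ of variables occurring positively, resp. negatively, are defined simultaneously by: $\mathcal{V}^+(p)=\{p\}$, $\mathcal{V}^+(\bot)=\emptyset$, $\mathcal{V}^+(A\land B)=\mathcal{V}^+(A\lor B)=\mathcal{V}^+(A)\cup\mathcal{V}^+(B)$, $\mathcal{V}^+(A\rightarrow B)=\mathcal{V}^-(A)\cup\mathcal{V}^+(B)$; $\mathcal{V}^-(p)=\mathcal{V}^-(\bot)=\emptyset$, $\mathcal{V}^-(A\land B)=\mathcal{V}^-(A\lor B)=\mathcal{V}^-(A)\cup\mathcal{V}^-(B)$, $\mathcal{V}^-(A\rightarrow B)=\mathcal{V}^+(A)\cup\mathcal{V}^-(B)$. The set of non-strictly positive variables: $\mathcal{V}^+_{ns}(p)=\mathcal{V}^+_{ns}(\bot)=\emptyset$, $\mathcal{V}^+_{ns}(A\land B)=\mathcal{V}^+_{ns}(A\lor B)=\mathcal{V}^+_{ns}(A)\cup\mathcal{V}^+_{ns}(B)$, $\mathcal{V}^+_{ns}(A\rightarrow B)=\mathcal{V}^-(A)\cup\mathcal{V}^+_{ns}(B)$.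 For a finite multiset $\Gamma$, $\mathcal{V}^+(\Gamma)=\bigcup_{B\in\Gamma}\mathcal{V}^+(B)$, similarly for $\mathcal{V}^-$, $\mathcal{V}^+_{ns}$. -}

module Defs where

open import Data.Nat using (ℕ)
open import Data.List using (List; []; _∷_)
open import Data.List.Membership.Propositional using (_∈_)
open import Data.Product using (_×_)
open import Data.Empty using (⊥)

infixr 5 _⇒_
infixr 6 _∨_
infixr 7 _∧_
data Formula : Set where
  var : ℕ → Formula
  ⊥'  : Formula
  _∧_ : Formula → Formula → Formula
  _∨_ : Formula → Formula → Formula
  _⇒_ : Formula → Formula → Formula

-- Finite multisets of formulas, represented as lists (derivability below is
-- insensitive to order / only membership matters for the hypothesis rule).
Ctx : Set
Ctx = List Formula

¬' : Formula → Formula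
¬' A = A ⇒ ⊥'

data Logic : Set where
  int cls : Logic

infix 3 _⊢[_]_
data _⊢[_]_ : Ctx → Logic → Formula → Set where
  hyp   : ∀ {L Γ A} → A ∈ Γ → Γ ⊢[ L ] A
  ⊥E    : ∀ {L Γ A} → Γ ⊢[ L ] ⊥' → Γ ⊢[ L ] A
  ∧I    : ∀ {L Γ A B} → Γ ⊢[ L ] A → Γ ⊢[ L ] B → Γ ⊢[ L ] A ∧ B
  ∧E₁   : ∀ {L Γ A B} → Γ ⊢[ L ] A ∧ B → Γ ⊢[ L ] A
  ∧E₂   : ∀ {L Γ A B} → Γ ⊢[ L ] A ∧ B → Γ ⊢[ L ] B
  ∨I₁   : ∀ {L Γ A B} → Γ ⊢[ L ] A → Γ ⊢[ L ] A ∨ B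
  ∨I₂   : ∀ {L Γ A B} → Γ ⊢[ L ] B → Γ ⊢[ L ] A ∨ B
  ∨E    : ∀ {L Γ A B C} → Γ ⊢[ L ] A ∨ B → (A ∷ Γ) ⊢[ L ] C → (B ∷ Γ) ⊢[ L ] C
          → Γ ⊢[ L ] C
  ⇒I    : ∀ {L Γ A B} → (A ∷ Γ) ⊢[ L ] B → Γ ⊢[ L ] A ⇒ B
  ⇒E    : ∀ {L Γ A B} → Γ ⊢[ L ] A ⇒ B → Γ ⊢[ L ] A → Γ ⊢[ L ] B
  raa   : ∀ {Γ A} → (¬' A ∷ Γ) ⊢[ cls ] ⊥' → Γ ⊢[ cls ] A

_⊢c_ : Ctx → Formula → Set
Γ ⊢c A = Γ ⊢[ cls ] A

_⊢i_ : Ctx → Formula → Set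
Γ ⊢i A = Γ ⊢[ int ] A

data _∈V⁺_ (p : ℕ) : Formula → Set
data _∈V⁻_ (p : ℕ) : Formula → Set

data _∈V⁺_ p where
  var : p ∈V⁺ var p
  ∧l  : ∀ {A B} → p ∈V⁺ A → p ∈V⁺ (A ∧ B)
  ∧r  : ∀ {A B} → p ∈V⁺ B → p ∈V⁺ (A ∧ B)
  ∨l  : ∀ {A B} → p ∈V⁺ A → p ∈V⁺ (A ∨ B)
  ∨r  : ∀ {A B} → p ∈V⁺ B → p ∈V⁺ (A ∨ B)
  ⇒l  : ∀ {A B} → p ∈V⁻ A → p ∈V⁺ (A ⇒ B)
  ⇒r  : ∀ {A B} → p ∈V⁺ B → p ∈V⁺ (A ⇒ B)

data _∈V⁻_ p where
  ∧l  : ∀ {A B} → p ∈V⁻ A → p ∈V⁻ (A ∧ B)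
  ∧r  : ∀ {A B} → p ∈V⁻ B → p ∈V⁻ (A ∧ B)
  ∨l  : ∀ {A B} → p ∈V⁻ A → p ∈V⁻ (A ∨ B)
  ∨r  : ∀ {A B} → p ∈V⁻ B → p ∈V⁻ (A ∨ B)
  ⇒l  : ∀ {A B} → p ∈V⁺ A → p ∈V⁻ (A ⇒ B)
  ⇒r  : ∀ {A B} → p ∈V⁻ B → p ∈V⁻ (A ⇒ B)

data _∈Vns_ (p : ℕ) : Formula → Set where
  ∧l  : ∀ {A B} → p ∈Vns A → p ∈Vns (A ∧ B)
  ∧r  : ∀ {A B} → p ∈Vns B → p ∈Vns (A ∧ B)
  ∨l  : ∀ {A B} → p ∈Vns A → p ∈Vns (A ∨ B)
  ∨r  : ∀ {A B} → p ∈Vns B → p ∈Vns (A ∨ B)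
  ⇒l  : ∀ {A B} → p ∈V⁻ A → p ∈Vns (A ⇒ B)
  ⇒r  : ∀ {A B} → p ∈Vns B → p ∈Vns (A ⇒ B)

data Some (P : Formula → Set) : Ctx → Set where
  here  : ∀ {B Γ} → P B → Some P (B ∷ Γ)
  there : ∀ {B Γ} → Some P Γ → Some P (B ∷ Γ)

_∈V⁺Γ_ _∈V⁻Γ_ _∈VnsΓ_ : ℕ → Ctx → Set
p ∈V⁺Γ Γ  = Some (p ∈V⁺_) Γ
p ∈V⁻Γ Γ  = Some (p ∈V⁻_) Γ
p ∈VnsΓ Γ = Some (p ∈Vns_) Γ

open import Data.Sum using (_⊎_)

Disjoint : (ℕ → Set) → (ℕ → Set) → Set
Disjoint X Y = ∀ p → X p → Y p → ⊥

module Submission where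

-- Fix A and a decidable set S of atoms containing 𝒱⁺(A) and disjoint from
-- 𝒱⁻(A); call a hypothesis B *safe* if 𝒱⁻(B) ⊆ S and 𝒱⁺ₙₛ(B) ∩ S = ∅.  The
-- proof is semantic: from Boolean entailment Γ ⊨ A (which follows from
-- Γ ⊢c A by soundness) we build an intuitionistic derivation of A.
--
--  * `verify`/`refute` read a formula off a valuation v: a true formula is
--    derivable once its true positive atoms are hypotheses and its negative
--    atoms are true; dually a false formula refutes itself.
--  * `derive` decomposes the safe hypotheses left-invertibly (∧, ∨, atoms, ⊥,
--    and implications whose premise is true in the *canonical valuation*:
--    atoms of S are true iff they are hypotheses, other atoms are true).  When
--    only implications with false premises remain, every hypothesis is true in
--    the canonical valuation, so A is true there and `verify` derives it.
--
-- Corollary 3.3 is the instance S = 𝒱⁻(Γ) ∪ 𝒱⁺(A).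

open import Defs
open import Data.Bool using (Bool; true; false; not) renaming (_∧_ to _&&_; _∨_ to _||_)
open import Data.Bool.Properties using (∧-conicalˡ; ∧-conicalʳ; ∨-zeroʳ)
open import Data.Nat using (ℕ; suc; _+_; _<_; s≤s; z≤n; _≟_)
open import Data.Nat.Properties
  using (≤-reflexive; ≤-trans; m≤m+n; m≤n+m; +-identityʳ; +-monoˡ-<; module ≤-Reasoning)
open import Data.Nat.Induction using (<-wellFounded)
open import Data.Nat.ListAction using (sum)
open import Data.Nat.ListAction.Properties using (sum-++; sum-↭)
open import Data.List using ([]; _∷_; [_]; _++_; map)
open import Data.List.Properties using (map-++)
open import Data.List.Relation.Unary.Any using (here; there; any?)
open import Data.List.Relation.Unary.All as All using (All; []; _∷_)
open import Data.List.Relation.Unary.All.Properties using (++⁺; ++⁻)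
open import Data.List.Membership.Propositional using (_∈_)
open import Data.List.Relation.Binary.Subset.Propositional using (_⊆_)
open import Data.List.Relation.Binary.Subset.Propositional.Properties
  using (⊆-refl; ⊆-trans; xs⊆x∷xs; xs⊆ys++xs; ⊆-reflexive-↭) renaming (++⁺ to ⊆-++⁺)
open import Data.List.Relation.Binary.Permutation.Propositional
  using (_↭_; ↭-refl; ↭-prep; ↭-swap; ↭-trans; ↭-sym)
open import Data.List.Relation.Binary.Permutation.Propositional.Properties
  using (All-resp-↭) renaming (map⁺ to ↭-map⁺)
open import Data.Product using (_×_; _,_; ∃₂)
open import Data.Sum using (_⊎_; inj₁; inj₂; [_,_]′)
open import Function using (_∘_)
open import Induction.WellFounded using (Acc; acc)
open import Relation.Binary.PropositionalEquality using (_≡_; refl; sym; trans; cong; cong₂)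
open import Relation.Nullary using (¬_; Dec; yes; no; does; contradiction)
open import Relation.Nullary.Decidable using (map′; _⊎-dec_; ¬?; dec-true)

Valuation : Set
Valuation = ℕ → Bool

⟦_⟧ : Formula → Valuation → Bool
⟦ var p ⟧ v = v p
⟦ ⊥' ⟧ v = false
⟦ C ∧ D ⟧ v = ⟦ C ⟧ v && ⟦ D ⟧ v
⟦ C ∨ D ⟧ v = ⟦ C ⟧ v || ⟦ D ⟧ v
⟦ C ⇒ D ⟧ v = not (⟦ C ⟧ v) || ⟦ D ⟧ v

infix 4 _⊨_ _⊨*_
_⊨_ : Valuation → Formula → Set
v ⊨ B = ⟦ B ⟧ v ≡ true

_⊨*_ : Valuation → Ctx → Set
v ⊨* Γ = All (v ⊨_) Γ

⊨-∧ : ∀ {v C D} → v ⊨ C → v ⊨ D → v ⊨ C ∧ D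
⊨-∧ = cong₂ _&&_

⊨-∨₁ : ∀ {v C D} → v ⊨ C → v ⊨ C ∨ D
⊨-∨₁ {v} {D = D} tC = cong (_|| ⟦ D ⟧ v) tC

⊨-∨₂ : ∀ {v C D} → v ⊨ D → v ⊨ C ∨ D
⊨-∨₂ {v} {C} tD = trans (cong (⟦ C ⟧ v ||_) tD) (∨-zeroʳ _)

⊨-⇒ : ∀ {v C D} → v ⊨ D → v ⊨ C ⇒ D
⊨-⇒ {v} {C} tD = trans (cong (not (⟦ C ⟧ v) ||_) tD) (∨-zeroʳ _)

sound : ∀ {L Γ B} → Γ ⊢[ L ] B → ∀ v → v ⊨* Γ → v ⊨ B
sound (hyp m) v γ = All.lookup γ m
sound (⊥E d) v γ = contradiction (sound d v γ) λ ()
sound (∧I {A = C} {B = D} d e) v γ = ⊨-∧ {C = C} {D} (sound d v γ) (sound e v γ)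
sound (∧E₁ d) v γ = ∧-conicalˡ _ _ (sound d v γ)
sound (∧E₂ d) v γ = ∧-conicalʳ _ _ (sound d v γ)
sound (∨I₁ {A = C} {B = D} d) v γ = ⊨-∨₁ {C = C} {D} (sound d v γ)
sound (∨I₂ {A = C} {B = D} d) v γ = ⊨-∨₂ {C = C} {D} (sound d v γ)
sound (∨E {A = C} d e f) v γ with ⟦ C ⟧ v in tC | sound d v γ
... | true  | _  = sound e v (tC ∷ γ)
... | false | tD = sound f v (tD ∷ γ)
sound (⇒I {A = C} d) v γ with ⟦ C ⟧ v in tC
... | true  = sound d v (tC ∷ γ)
... | false = refl
sound (⇒E {A = C} d e) v γ with ⟦ C ⟧ v | sound d v γ | sound e v γ
... | true  | tD | _  = tD
... | false | _  | ()
sound (raa {A = C} d) v γ with ⟦ C ⟧ v in tC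
... | true  = refl
... | false = contradiction (sound d v (cong (λ b → not b || false) tC ∷ γ)) λ ()

verify : ∀ {v Δ} B → (∀ {p} → p ∈V⁺ B → v p ≡ true → var p ∈ Δ)
       → (∀ {p} → p ∈V⁻ B → v p ≡ true) → v ⊨ B → Δ ⊢i B

refute : ∀ {v Δ} B → (∀ {p} → p ∈V⁺ B → v p ≡ true)
       → (∀ {p} → p ∈V⁻ B → v p ≡ true → var p ∈ Δ) → ⟦ B ⟧ v ≡ false
       → Δ ⊢i B → Δ ⊢i ⊥'

verify (var p) pos neg t = hyp (pos var t)
verify ⊥' pos neg ()
verify (C ∧ D) pos neg t =
  ∧I (verify C (pos ∘ ∧l) (neg ∘ ∧l) (∧-conicalˡ _ _ t))
     (verify D (pos ∘ ∧r) (neg ∘ ∧r) (∧-conicalʳ _ _ t))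
verify {v} (C ∨ D) pos neg t with ⟦ C ⟧ v in tC
... | true  = ∨I₁ (verify C (pos ∘ ∨l) (neg ∘ ∨l) tC)
... | false = ∨I₂ (verify D (pos ∘ ∨r) (neg ∘ ∨r) t)
verify {v} (C ⇒ D) pos neg t with ⟦ C ⟧ v in tC
... | true  = ⇒I (verify D (λ q e → there (pos (⇒r q) e)) (neg ∘ ⇒r) t)
... | false = ⇒I (⊥E (refute C (neg ∘ ⇒l) (λ q e → there (pos (⇒l q) e)) tC (hyp (here refl))))

refute (var p) pos neg f d = contradiction (trans (sym (pos var)) f) λ ()
refute ⊥' pos neg f d = d
refute {v} (C ∧ D) pos neg f d with ⟦ C ⟧ v in tC
... | false = refute C (pos ∘ ∧l) (neg ∘ ∧l) tC (∧E₁ d)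
... | true  = refute D (pos ∘ ∧r) (neg ∘ ∧r) f (∧E₂ d)
refute {v} (C ∨ D) pos neg f d with ⟦ C ⟧ v in tC
... | true  = contradiction f λ ()
... | false = ∨E d (refute C (pos ∘ ∨l) (λ q e → there (neg (∨l q) e)) tC (hyp (here refl)))
                   (refute D (pos ∘ ∨r) (λ q e → there (neg (∨r q) e)) f (hyp (here refl)))
refute {v} (C ⇒ D) pos neg f d with ⟦ C ⟧ v in tC
... | false = contradiction f λ ()
... | true  = refute D (pos ∘ ⇒r) (neg ∘ ⇒r) f (⇒E d (verify C (neg ∘ ⇒l) (pos ∘ ⇒l) tC))

var-≟ : ∀ p B → Dec (var p ≡ B)
var-≟ p (var q) = map′ (cong var) (λ { refl → refl }) (p ≟ q)
var-≟ p ⊥' = no λ ()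
var-≟ p (C ∧ D) = no λ ()
var-≟ p (C ∨ D) = no λ ()
var-≟ p (C ⇒ D) = no λ ()

var-∈? : ∀ p Δ → Dec (var p ∈ Δ)
var-∈? p = any? (var-≟ p)

_∈V⁺?_ : ∀ p B → Dec (p ∈V⁺ B)
_∈V⁻?_ : ∀ p B → Dec (p ∈V⁻ B)

p ∈V⁺? var q = map′ (λ { refl → var }) (λ { var → refl }) (p ≟ q)
p ∈V⁺? ⊥' = no λ ()
p ∈V⁺? (C ∧ D) =
  map′ [ ∧l , ∧r ]′ (λ { (∧l x) → inj₁ x ; (∧r x) → inj₂ x }) (p ∈V⁺? C ⊎-dec p ∈V⁺? D)
p ∈V⁺? (C ∨ D) =
  map′ [ ∨l , ∨r ]′ (λ { (∨l x) → inj₁ x ; (∨r x) → inj₂ x }) (p ∈V⁺? C ⊎-dec p ∈V⁺? D)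
p ∈V⁺? (C ⇒ D) =
  map′ [ ⇒l , ⇒r ]′ (λ { (⇒l x) → inj₁ x ; (⇒r x) → inj₂ x }) (p ∈V⁻? C ⊎-dec p ∈V⁺? D)

p ∈V⁻? var q = no λ ()
p ∈V⁻? ⊥' = no λ ()
p ∈V⁻? (C ∧ D) =
  map′ [ ∧l , ∧r ]′ (λ { (∧l x) → inj₁ x ; (∧r x) → inj₂ x }) (p ∈V⁻? C ⊎-dec p ∈V⁻? D)
p ∈V⁻? (C ∨ D) =
  map′ [ ∨l , ∨r ]′ (λ { (∨l x) → inj₁ x ; (∨r x) → inj₂ x }) (p ∈V⁻? C ⊎-dec p ∈V⁻? D)
p ∈V⁻? (C ⇒ D) =
  map′ [ ⇒l , ⇒r ]′ (λ { (⇒l x) → inj₁ x ; (⇒r x) → inj₂ x }) (p ∈V⁺? C ⊎-dec p ∈V⁻? D)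

some? : ∀ {P : Formula → Set} → (∀ B → Dec (P B)) → ∀ Γ → Dec (Some P Γ)
some? P? [] = no λ ()
some? P? (B ∷ Γ) =
  map′ [ here , there ]′ (λ { (here x) → inj₁ x ; (there x) → inj₂ x }) (P? B ⊎-dec some? P? Γ)

some : ∀ {P : Formula → Set} {B Γ} → B ∈ Γ → P B → Some P Γ
some (here refl) x = here x
some (there m) x = there (some m x)

data Blocked (v : Valuation) : Formula → Set where
  blocked : ∀ {P Q} → ⟦ P ⟧ v ≡ false → Blocked v (P ⇒ Q)

blocked-true : ∀ {v B} → Blocked v B → v ⊨ B
blocked-true (blocked fP) = cong (λ b → not b || _) fP

data Reducible (v : Valuation) : Formula → Set where
  atom   : ∀ {p} → Reducible v (var p)
  falsum : Reducible v ⊥'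
  conj   : ∀ {C D} → Reducible v (C ∧ D)
  disj   : ∀ {C D} → Reducible v (C ∨ D)
  impl   : ∀ {P Q} → v ⊨ P → Reducible v (P ⇒ Q)

classify : ∀ v B → Blocked v B ⊎ Reducible v B
classify v (var p) = inj₂ atom
classify v ⊥' = inj₂ falsum
classify v (C ∧ D) = inj₂ conj
classify v (C ∨ D) = inj₂ disj
classify v (P ⇒ Q) with ⟦ P ⟧ v in tP
... | true  = inj₂ (impl tP)
... | false = inj₁ (blocked tP)

pick : ∀ v Φ → All (Blocked v) Φ ⊎ ∃₂ λ B Φ' → Φ ↭ B ∷ Φ' × Reducible v B
pick v [] = inj₁ []
pick v (B ∷ Φ) with classify v B
... | inj₂ r = inj₂ (B , Φ , ↭-refl , r)
... | inj₁ b with pick v Φ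
...   | inj₁ bs = inj₁ (b ∷ bs)
...   | inj₂ (B' , Φ' , σ , r) =
  inj₂ (B' , B ∷ Φ' , ↭-trans (↭-prep B σ) (↭-swap B B' ↭-refl) , r)

fsize : Formula → ℕ
fsize (var p) = 1
fsize ⊥' = 1
fsize (C ∧ D) = suc (fsize C + fsize D)
fsize (C ∨ D) = suc (fsize C + fsize D)
fsize (C ⇒ D) = suc (fsize C + fsize D)

size : Ctx → ℕ
size Φ = sum (map fsize Φ)

size-++ : ∀ Θ Φ → size (Θ ++ Φ) ≡ size Θ + size Φ
size-++ Θ Φ = trans (cong sum (map-++ fsize Θ Φ)) (sum-++ (map fsize Θ) (map fsize Φ))

shrink : ∀ {Φ B Φ'} Θ → Φ ↭ B ∷ Φ' → size Θ < fsize B → size (Θ ++ Φ') < size Φ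
shrink {Φ} {B} {Φ'} Θ σ lt = begin-strict
  size (Θ ++ Φ')     ≡⟨ size-++ Θ Φ' ⟩
  size Θ + size Φ'   <⟨ +-monoˡ-< (size Φ') lt ⟩
  size (B ∷ Φ')      ≡⟨ sum-↭ (↭-map⁺ fsize (↭-sym σ)) ⟩
  size Φ             ∎
  where open ≤-Reasoning

left< : ∀ m n → m + 0 < suc (m + n)
left< m n = s≤s (≤-trans (≤-reflexive (+-identityʳ m)) (m≤m+n m n))

right< : ∀ m n → n + 0 < suc (m + n)
right< m n = s≤s (≤-trans (≤-reflexive (+-identityʳ n)) (m≤n+m n m))

both< : ∀ m n → m + (n + 0) < suc (m + n)
both< m n = s≤s (≤-reflexive (cong (m +_) (+-identityʳ n)))

cut : ∀ {L Δ X Y} → Δ ⊢[ L ] X → X ∷ Δ ⊢[ L ] Y → Δ ⊢[ L ] Y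
cut d e = ⇒E (⇒I e) d

AtomsHold : Valuation → Ctx → Set
AtomsHold v Δ = ∀ {p} → var p ∈ Δ → v p ≡ true

module Compatible
  (A : Formula) (S : ℕ → Set) (S? : ∀ p → Dec (S p))
  (A⁺⊆S : ∀ {p} → p ∈V⁺ A → S p) (A⁻∩S : ∀ {p} → p ∈V⁻ A → ¬ S p) where

  Safe : Formula → Set
  Safe B = (∀ {p} → p ∈V⁻ B → S p) × (∀ {p} → p ∈Vns B → ¬ S p)

  safe-part : ∀ {B E} → (∀ {p} → p ∈V⁻ E → p ∈V⁻ B) → (∀ {p} → p ∈Vns E → p ∈Vns B)
            → Safe B → Safe E
  safe-part i j (neg , ns) = neg ∘ i , ns ∘ j

  TrueAtom : Ctx → ℕ → Set
  TrueAtom Δ p = var p ∈ Δ ⊎ ¬ S p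

  trueAtom? : ∀ Δ p → Dec (TrueAtom Δ p)
  trueAtom? Δ p = var-∈? p Δ ⊎-dec ¬? (S? p)

  canon : Ctx → Valuation
  canon Δ p = does (trueAtom? Δ p)

  canon-sound : ∀ {Δ p} → canon Δ p ≡ true → TrueAtom Δ p
  canon-sound {Δ} {p} = witness (trueAtom? Δ p)
    where
      witness : ∀ {X} (x? : Dec X) → does x? ≡ true → X
      witness (yes x) _ = x
      witness (no _) ()

  canon-hyp : ∀ {Δ} → AtomsHold (canon Δ) Δ
  canon-hyp {Δ} m = dec-true (trueAtom? Δ _) (inj₁ m)

  canon-free : ∀ {Δ p} → ¬ S p → canon Δ p ≡ true
  canon-free {Δ} {p} ¬s = dec-true (trueAtom? Δ p) (inj₂ ¬s)

  canon-S : ∀ {Δ p} → S p → canon Δ p ≡ true → var p ∈ Δ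
  canon-S s t with canon-sound t
  ... | inj₁ m  = m
  ... | inj₂ ¬s = contradiction s ¬s

  record Agenda (Δ Φ : Ctx) : Set where
    field
      recorded : Φ ⊆ Δ
      safe     : All Safe Φ
      entails  : ∀ v → AtomsHold v Δ → v ⊨* Φ → v ⊨ A
  open Agenda

  reorder : ∀ {Δ Φ Ψ} → Φ ↭ Ψ → Agenda Δ Φ → Agenda Δ Ψ
  reorder σ ag = record
    { recorded = ⊆-trans (⊆-reflexive-↭ (↭-sym σ)) (recorded ag)
    ; safe     = All-resp-↭ σ (safe ag)
    ; entails  = λ v atoms → entails ag v atoms ∘ All-resp-↭ (↭-sym σ)
    }

  descend : ∀ {Δ Φ B} → Agenda Δ (B ∷ Φ) → ∀ Θ → All Safe Θ
          → (∀ v → AtomsHold v (Θ ++ Δ) → v ⊨* Θ → v ⊨ B) → Agenda (Θ ++ Δ) (Θ ++ Φ)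
  descend {Δ} {Φ} {B} ag Θ safeΘ entailsB = record
    { recorded = ⊆-++⁺ ⊆-refl (⊆-trans (xs⊆x∷xs Φ B) (recorded ag))
    ; safe     = ++⁺ safeΘ (All.tail (safe ag))
    ; entails  = λ v atoms vΘΦ → let (vΘ , vΦ) = ++⁻ Θ vΘΦ in
        entails ag v (atoms ∘ xs⊆ys++xs Δ Θ) (entailsB v atoms vΘ ∷ vΦ)
    }

  -- What the recursion provides when decomposing a hypothesis B of Δ.
  Continuation : Ctx → Formula → Set
  Continuation Δ B = ∀ Θ → size Θ < fsize B → All Safe Θ
                   → (∀ v → AtomsHold v (Θ ++ Δ) → v ⊨* Θ → v ⊨ B) → (Θ ++ Δ) ⊢i A

  step : ∀ {Δ B} → Reducible (canon Δ) B → B ∈ Δ → Safe B → Continuation Δ B → Δ ⊢i A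
  step atom m _ k = k [] (s≤s z≤n) [] λ v atoms _ → atoms m
  step falsum m _ k = ⊥E (hyp m)
  step (conj {C} {D}) m s k =
    cut (∧E₂ (hyp m)) (cut (∧E₁ (hyp (there m)))
      (k (C ∷ D ∷ []) (both< (fsize C) (fsize D)) (safe-part ∧l ∧l s ∷ safe-part ∧r ∧r s ∷ [])
         λ { v _ (tC ∷ tD ∷ []) → ⊨-∧ {C = C} {D} tC tD }))
  step (disj {C} {D}) m s k =
    ∨E (hyp m)
      (k [ C ] (left< (fsize C) (fsize D)) (safe-part ∨l ∨l s ∷ [])
         λ { v _ (tC ∷ []) → ⊨-∨₁ {C = C} {D} tC })
      (k [ D ] (right< (fsize C) (fsize D)) (safe-part ∨r ∨r s ∷ [])
         λ { v _ (tD ∷ []) → ⊨-∨₂ {C = C} {D} tD })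
  step {Δ} (impl {P} {Q} tP) m s@(neg , ns) k =
    cut (⇒E (hyp m) premise)
      (k [ Q ] (right< (fsize P) (fsize Q)) (safe-part ⇒r ⇒r s ∷ [])
         λ { v _ (tQ ∷ []) → ⊨-⇒ {C = P} {Q} tQ })
    where
      -- the premise is true, its positive atoms are in S and its negative ones are not
      premise : Δ ⊢i P
      premise = verify P (canon-S {Δ} ∘ neg ∘ ⇒l) (canon-free {Δ} ∘ ns ∘ ⇒l) tP

  -- Decompose until every remaining hypothesis is blocked; then all of them
  -- hold in the canonical valuation, hence so does A.
  derive : ∀ {Δ Φ} → Acc _<_ (size Φ) → Agenda Δ Φ → Δ ⊢i A
  derive {Δ} {Φ} (acc rec) ag with pick (canon Δ) Φ
  ... | inj₁ bs =
    verify A (canon-S {Δ} ∘ A⁺⊆S) (canon-free {Δ} ∘ A⁻∩S)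
      (entails ag (canon Δ) canon-hyp (All.map blocked-true bs))
  ... | inj₂ (B , Φ' , σ , r) =
    step r (recorded ag' (here refl)) (All.head (safe ag')) λ Θ lt safeΘ entailsB →
      derive (rec (shrink Θ σ lt)) (descend ag' Θ safeΘ entailsB)
    where
      ag' : Agenda Δ (B ∷ Φ')
      ag' = reorder σ ag

  complete : ∀ Γ → All Safe Γ → (∀ v → v ⊨* Γ → v ⊨ A) → Γ ⊢i A
  complete Γ safeΓ ⊨A = derive (<-wellFounded (size Γ)) record
    { recorded = ⊆-refl ; safe = safeΓ ; entails = λ v _ → ⊨A v }

-- Corollary 3.3: take S = 𝒱⁻(Γ) ∪ 𝒱⁺(A); the disjointness hypothesis says
-- exactly that 𝒱⁻(A) avoids S and that every member of Γ is safe.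
corollary3p3 : (Γ : Ctx) (A : Formula) → Γ ⊢c A
    → Disjoint (λ p → p ∈V⁻Γ Γ ⊎ p ∈V⁺ A) (λ p → p ∈VnsΓ Γ ⊎ p ∈V⁻ A)
    → Γ ⊢i A
corollary3p3 Γ A d disjoint = complete Γ (All.tabulate safe) (sound d)
  where
    S : ℕ → Set
    S p = p ∈V⁻Γ Γ ⊎ p ∈V⁺ A

    S? : ∀ p → Dec (S p)
    S? p = some? (p ∈V⁻?_) Γ ⊎-dec p ∈V⁺? A

    open Compatible A S S? inj₂ (λ q s → disjoint _ s (inj₂ q))

    safe : ∀ {B} → B ∈ Γ → Safe B
    safe m = (λ q → inj₁ (some m q)) , (λ q s → disjoint _ s (inj₁ (some m q)))
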